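{- If $G$ is a graph with no connected component having exactly two vertices, then $\gamma(S_2(G))=\gamma_{\rm cer}(S_2(G))$.
   Context: All graphs are finite and simple. The $2$-subdivision $S_2(G)$ of $G$ is obtained from $G$ by replacing each edge $e=uv$ by a path $(u,u_e,v_e,v)$, where $u_e,v_e$ are two new vertices. A dominating set of a graph $H$ is a set $D\subseteq V_H$ such that every vertex of $V_H-D$ has a neighbor in $D$; $\gamma(H)$ is the minimum cardinality of a dominating set. A certified dominating set of $H$ is a dominating set $D$ such that every vertex in $D$ has either zero or at least two neighbors in $V_H-D$; $\gamma_{\rm cer}(H)$ is its minimum cardinality. -}

module Defs where

open import Data.Nat using (ℕ; _≤_)
open import Data.Fin using (Fin)
open import Data.Bool using (Bool; true; false)
open import Data.Sum using (_⊎_; inj₁; inj₂)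
open import Data.Product using (Σ; ∃; ∃-syntax; _×_; _,_)
open import Data.List using (List; length)
open import Data.List.Membership.Propositional using (_∈_; _∉_)
open import Data.List.Relation.Unary.Unique.Propositional using (Unique)
open import Relation.Binary.PropositionalEquality using (_≡_; _≢_)
open import Relation.Nullary using (¬_)

record Graph : Set where
  field
    n     : ℕ
    E     : Fin n → Fin n → Bool
    sym   : ∀ u v → E u v ≡ E v u
    irrefl : ∀ v → E v v ≡ false

open Graph public

Adj : (G : Graph) → Fin (n G) → Fin (n G) → Set
Adj G u v = E G u v ≡ true

data Reach (G : Graph) : Fin (n G) → Fin (n G) → Set where
  here : ∀ {u} → Reach G u u
  step : ∀ {u v w} → Adj G u v → Reach G v w → Reach G u w

HasComponentOfSize2 : Graph → Set
HasComponentOfSize2 G =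
  ∃[ u ] ∃[ w ] (u ≢ w × Reach G u w ×
     (∀ x → Reach G u x → (x ≡ u ⊎ x ≡ w)))

-- A vertex subset is a
-- duplicate-free list; its cardinality is the length of the list.

IsDominating : {V : Set} → (V → V → Set) → List V → Set
IsDominating {V} A D = ∀ (v : V) → v ∈ D ⊎ (∃[ u ] (u ∈ D × A u v))

IsCertifiedDominating : {V : Set} → (V → V → Set) → List V → Set
IsCertifiedDominating {V} A D =
  IsDominating A D ×
  (∀ v → v ∈ D →
     (∀ u → A v u → u ∈ D)
     ⊎ (∃[ u ] ∃[ w ] (u ≢ w × A v u × A v w × u ∉ D × w ∉ D)))

IsMinCard : {V : Set} → (List V → Set) → ℕ → Set
IsMinCard {V} P k =
  (∃[ D ] (Unique D × P D × length D ≡ k)) ×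
  (∀ D → Unique D → P D → k ≤ length D)

IsDominationNumber : {V : Set} → (V → V → Set) → ℕ → Set
IsDominationNumber A k = IsMinCard (IsDominating A) k

IsCertifiedDominationNumber : {V : Set} → (V → V → Set) → ℕ → Set
IsCertifiedDominationNumber A k = IsMinCard (IsCertifiedDominating A) k

-- Vertices: original vertices (inj₁ v), and for
-- every edge e = uv the two new vertices u_e, v_e; u_e is encoded as the
-- ordered pair (u , v) with Adj G u v (so (u,v) and (v,u) are the two
-- subdivision vertices of the same edge).

S2V : Graph → Set
S2V G = Fin (n G) ⊎ Σ (Fin (n G) × Fin (n G)) (λ { (u , v) → Adj G u v })

data S2Adj (G : Graph) : S2V G → S2V G → Set where
  orig-sub : ∀ {u v} (e : Adj G u v) → S2Adj G (inj₁ u) (inj₂ ((u , v) , e))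
  sub-orig : ∀ {u v} (e : Adj G u v) → S2Adj G (inj₂ ((u , v) , e)) (inj₁ u)
  sub-sub  : ∀ {u v} (e : Adj G u v) (e' : Adj G v u) →
             S2Adj G (inj₂ ((u , v) , e)) (inj₂ ((v , u) , e'))

-- A minimum dominating set D of S₂(G) exists because S₂(G) is finite. If a vertex of D has
-- exactly one neighbour outside D, a local repair (deleting a subdivision vertex, or replacing
-- a vertex of D by a nearby vertex) yields a dominating set that is no larger and strictly
-- lighter for the weight `cost` below, so iterating ends in a certified dominating set of size
-- γ(S₂(G)). The one configuration admitting no repair is a pair of adjacent leaves of G, i.e.
-- a K₂ component whose 2-subdivision is P₄, and this is what the hypothesis excludes.

module Submission where

open import Defs hiding (sym)
open import Axiom.UniquenessOfIdentityProofs using (module Decidable⇒UIP)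
open import Data.Bool using (true; false; if_then_else_)
import Data.Bool.Properties as Bool
open import Data.Empty using (⊥-elim)
open import Data.Fin using (Fin)
import Data.Fin.Properties as Fin
open import Data.List using (List; []; _∷_; length; map; filter; _++_; allFin; cartesianProduct; deduplicate)
open import Data.List.Extrema.Nat using (argmin; f[argmin]≤f[xs]; argmin-all)
open import Data.List.Membership.Propositional using (_∈_; _∉_; find; lose)
open import Data.List.Membership.Propositional.Properties
  using ( ∈-filter⁺; ∈-filter⁻; ∈-map⁺; ∈-++⁺ˡ; ∈-++⁺ʳ; ∈-allFin; ∈-cartesianProduct⁺
        ; ∈-deduplicate⁺)
import Data.List.Membership.DecPropositional as DecMembership
open import Data.List.Properties using (length-removeAt′)
open import Data.List.Relation.Binary.Subset.Propositional using (_⊆_)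
import Data.List.Relation.Unary.All as All
open import Data.List.Relation.Unary.All.Properties using (─⁺; all-filter; ¬Any⇒All¬)
open import Data.List.Relation.Unary.AllPairs using ([]; _∷_)
open import Data.List.Relation.Unary.Any as Any using (here; there; index; _─_)
open import Data.List.Relation.Unary.Unique.Propositional using (Unique)
open import Data.List.Relation.Unary.Unique.Propositional.Properties using (Unique[x∷xs]⇒x∉xs)
import Data.List.Relation.Unary.Unique.Propositional.Properties as Unique
import Data.List.Relation.Unary.Unique.DecPropositional as DecUnique
open import Data.List.Relation.Unary.Unique.DecPropositional.Properties using (deduplicate-!)
open import Data.Nat using (ℕ; suc; _+_; _≤_; _<_; z≤n; s≤s)
open import Data.Nat.Induction using (<-wellFounded)
open import Data.Nat.ListAction using (sum)
open import Data.Nat.Properties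
  using (module ≤-Reasoning; ≤-refl; ≤-trans; ≤-antisym; n≤1+n; +-comm; +-assoc; +-monoˡ-<; m≤n+m)
open import Data.Product using (Σ; ∃-syntax; _×_; _,_; proj₁; proj₂; uncurry)
open import Data.Product.Properties using () renaming (≡-dec to Σ-≡-dec)
open import Data.Sum as Sum using (_⊎_; inj₁; inj₂; [_,_]′)
open import Data.Sum.Properties using (inj₂-injective) renaming (≡-dec to ⊎-≡-dec)
open import Function using (id; _∘_)
open import Induction.WellFounded using (Acc; acc)
open import Relation.Binary.Definitions using (DecidableEquality)
open import Relation.Binary.PropositionalEquality
  using (_≡_; _≢_; refl; sym; trans; cong; subst; module ≡-Reasoning)
open import Relation.Nullary using (¬_; Dec; yes; no; does; contradiction)
open import Relation.Nullary.Decidable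
  using (map′; ¬?; _×-dec_; _⊎-dec_; dec-true; dec-false; decidable-stable)
open import Relation.Unary using (Decidable)

module _ {V : Set} where

  ∈-─⁻ : ∀ {x y} {xs : List V} (p : x ∈ xs) → y ∈ (xs ─ p) → y ∈ xs
  ∈-─⁻ (here _)  y∈ = there y∈
  ∈-─⁻ (there p) (here y≡) = here y≡
  ∈-─⁻ (there p) (there y∈) = there (∈-─⁻ p y∈)

  ∈⇒≡⊎∈-─ : ∀ {x y} {xs : List V} (p : x ∈ xs) → y ∈ xs → y ≡ x ⊎ y ∈ (xs ─ p)
  ∈⇒≡⊎∈-─ (here refl) (here refl) = inj₁ refl
  ∈⇒≡⊎∈-─ (here refl) (there y∈) = inj₂ y∈
  ∈⇒≡⊎∈-─ (there p)   (here y≡)  = inj₂ (here y≡)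
  ∈⇒≡⊎∈-─ (there p)   (there y∈) = Sum.map₂ there (∈⇒≡⊎∈-─ p y∈)

  ∈-─⁺ : ∀ {x y} {xs : List V} (p : x ∈ xs) → y ∈ xs → y ≢ x → y ∈ (xs ─ p)
  ∈-─⁺ p y∈ y≢x = [ (λ y≡x → contradiction y≡x y≢x) , id ]′ (∈⇒≡⊎∈-─ p y∈)

  Unique-─ : ∀ {x} {xs : List V} (p : x ∈ xs) → Unique xs → Unique (xs ─ p)
  Unique-─ (here _)  (_ ∷ u)  = u
  Unique-─ (there p) (a ∷ u) = ─⁺ p a ∷ Unique-─ p u

  length-─ : ∀ {x} {xs : List V} (p : x ∈ xs) → length xs ≡ suc (length (xs ─ p))
  length-─ {xs = xs} p = length-removeAt′ xs (index p)

  sum-map-─ : ∀ (f : V → ℕ) {x} {xs : List V} (p : x ∈ xs) →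
              sum (map f xs) ≡ f x + sum (map f (xs ─ p))
  sum-map-─ f (here refl) = refl
  sum-map-─ f {x} {y ∷ xs} (there p) = begin
    f y + sum (map f xs)                ≡⟨ cong (f y +_) (sum-map-─ f p) ⟩
    f y + (f x + sum (map f (xs ─ p)))  ≡⟨ sym (+-assoc (f y) (f x) _) ⟩
    f y + f x + sum (map f (xs ─ p))    ≡⟨ cong (_+ sum (map f (xs ─ p))) (+-comm (f y) (f x)) ⟩
    f x + f y + sum (map f (xs ─ p))    ≡⟨ +-assoc (f x) (f y) _ ⟩
    f x + (f y + sum (map f (xs ─ p)))  ∎
    where open ≡-Reasoning

  Unique-⊆⇒length≤ : ∀ {xs ys : List V} → Unique xs → xs ⊆ ys → length xs ≤ length ys
  Unique-⊆⇒length≤ {[]} _ _ = z≤n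
  Unique-⊆⇒length≤ {x ∷ xs} {ys} u@(_ ∷ uxs) xs⊆ys = begin
    suc (length xs)          ≤⟨ s≤s (Unique-⊆⇒length≤ uxs xs⊆ys─x) ⟩
    suc (length (ys ─ x∈ys)) ≡⟨ sym (length-─ x∈ys) ⟩
    length ys                ∎
    where
    open ≤-Reasoning
    x∈ys = xs⊆ys (here refl)
    xs⊆ys─x : xs ⊆ (ys ─ x∈ys)
    xs⊆ys─x z∈ = ∈-─⁺ x∈ys (xs⊆ys (there z∈)) λ { refl → Unique[x∷xs]⇒x∉xs u z∈ }

module _ {X : Set} {P : X → Set} (P? : ∀ a → Dec (P a)) where

  sieve : List X → List (Σ X P)
  sieve []       = []
  sieve (a ∷ as) with P? a
  ... | yes pa = (a , pa) ∷ sieve as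
  ... | no _   = sieve as

  ∈-sieve⁺ : (∀ {a} (p q : P a) → p ≡ q) →
             ∀ {a as} → a ∈ as → (pa : P a) → (a , pa) ∈ sieve as
  ∈-sieve⁺ irr {a} {a′ ∷ as} a∈ pa with P? a′ | a∈
  ... | yes pa′ | here refl = here (cong (a ,_) (irr pa pa′))
  ... | yes _   | there a∈as = there (∈-sieve⁺ irr a∈as pa)
  ... | no ¬pa′ | here refl = ⊥-elim (¬pa′ pa)
  ... | no _    | there a∈as = ∈-sieve⁺ irr a∈as pa

module _ {V : Set} (_≟_ : DecidableEquality V) where
  open DecMembership _≟_ using (_∈?_)
  open DecUnique _≟_ using (unique?)

  sublists : List V → List (List V)
  sublists []       = [] ∷ []
  sublists (x ∷ xs) = map (x ∷_) (sublists xs) ++ sublists xs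

  filter∈sublists : ∀ {P : V → Set} (P? : Decidable P) xs → filter P? xs ∈ sublists xs
  filter∈sublists P? []       = here refl
  filter∈sublists P? (x ∷ xs) with P? x
  ... | yes _ = ∈-++⁺ˡ (∈-map⁺ (x ∷_) (filter∈sublists P? xs))
  ... | no _  = ∈-++⁺ʳ (map (x ∷_) (sublists xs)) (filter∈sublists P? xs)

  minCard-exists : ∀ {P : List V → Set} → Decidable P → (∀ {L L'} → P L → L ⊆ L' → P L') →
                   ∀ {vs} → Unique vs → (∀ v → v ∈ vs) → P vs → ∃[ k ] IsMinCard P k
  minCard-exists {P} P? P-mono {vs} uvs enum pvs =
    length best , (best , proj₁ best-is-candidate , proj₂ best-is-candidate , refl) , minimal
    where
    Candidate : List V → Set
    Candidate L = Unique L × P L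

    candidate? : Decidable Candidate
    candidate? L = unique? L ×-dec P? L

    best : List V
    best = argmin length vs (filter candidate? (sublists vs))

    best-is-candidate : Candidate best
    best-is-candidate = argmin-all length {P = Candidate} (uvs , pvs) (all-filter candidate? (sublists vs))

    minimal : ∀ D → Unique D → P D → length best ≤ length D
    minimal D uD pD = begin
      length best ≤⟨ All.lookup (f[argmin]≤f[xs] {f = length} vs _) vs∩D-is-candidate ⟩
      length vs∩D ≤⟨ Unique-⊆⇒length≤ unique-vs∩D (proj₂ ∘ ∈-filter⁻ (_∈? D) {xs = vs}) ⟩
      length D    ∎
      where
      open ≤-Reasoning
      vs∩D : List V
      vs∩D = filter (_∈? D) vs

      unique-vs∩D : Unique vs∩D
      unique-vs∩D = Unique.filter⁺ (_∈? D) uvs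

      vs∩D-is-candidate : vs∩D ∈ filter candidate? (sublists vs)
      vs∩D-is-candidate = ∈-filter⁺ candidate? (filter∈sublists (_∈? D) vs)
        (unique-vs∩D , P-mono pD (λ {z} z∈ → ∈-filter⁺ (_∈? D) (enum z) z∈))

module Domination {V : Set} (A : V → V → Set) where

  Dominated : List V → V → Set
  Dominated L v = v ∈ L ⊎ ∃[ u ] (u ∈ L × A u v)

  CertifiedAt : List V → V → Set
  CertifiedAt D v =
    (∀ u → A v u → u ∈ D) ⊎ (∃[ u ] ∃[ w ] (u ≢ w × A v u × A v w × u ∉ D × w ∉ D))

  Dominated-mono : ∀ {L L' v} → L ⊆ L' → Dominated L v → Dominated L' v
  Dominated-mono L⊆L' = Sum.map L⊆L' λ (u , u∈ , a) → u , L⊆L' u∈ , a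

  IsDominating-mono : ∀ {L L'} → IsDominating A L → L ⊆ L' → IsDominating A L'
  IsDominating-mono dL L⊆L' v = Dominated-mono L⊆L' (dL v)

  dominating? : DecidableEquality V → (∀ u v → Dec (A u v)) → ∀ {vs} → (∀ v → v ∈ vs) →
                Decidable (IsDominating A)
  dominating? _≟_ A? {vs} enum L =
    map′ (λ all v → All.lookup all (enum v)) (λ dL → All.tabulate λ {v} _ → dL v)
         (All.all? dominated? vs)
    where
    open DecMembership _≟_ using (_∈?_)
    dominated? : Decidable (Dominated L)
    dominated? v =
      v ∈? L ⊎-dec map′ find (λ (u , u∈ , a) → lose u∈ a) (Any.any? (λ u → A? u v) L)

  IsDominating-replace : ∀ {D L x} → IsDominating A D → (p : x ∈ D) → (D ─ p) ⊆ L →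
    Dominated L x → (∀ z → A x z → Dominated L z) → IsDominating A L
  IsDominating-replace dD p D─x⊆L dx dN v with dD v
  ... | inj₁ v∈D with ∈⇒≡⊎∈-─ p v∈D
  ...   | inj₁ refl = dx
  ...   | inj₂ v∈D─x = inj₁ (D─x⊆L v∈D─x)
  IsDominating-replace dD p D─x⊆L dx dN v | inj₂ (u , u∈D , a) with ∈⇒≡⊎∈-─ p u∈D
  ...   | inj₁ refl = dN v a
  ...   | inj₂ u∈D─x = inj₂ (u , D─x⊆L u∈D─x , a)

  CertifiedReduction : List V → Set
  CertifiedReduction D = ∃[ D' ] (Unique D' × IsCertifiedDominating A D' × length D' ≤ length D)

  dominationNumber⇒certifiedDominationNumber :
    (∀ {D} → Unique D → IsDominating A D → CertifiedReduction D) →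
    ∀ {k} → IsDominationNumber A k → IsCertifiedDominationNumber A k
  dominationNumber⇒certifiedDominationNumber reduce ((D , uD , dD , refl) , minimal) with reduce uD dD
  ... | D' , uD' , cD' , D'≤D =
    (D' , uD' , cD' , ≤-antisym D'≤D (minimal D' uD' (proj₁ cD'))) ,
    λ D'' uD'' cD'' → minimal D'' uD'' (proj₁ cD'')

  module Descent (cost : V → ℕ) where

    weight : List V → ℕ
    weight L = sum (map (suc ∘ cost) L)

    Improvement : List V → Set
    Improvement D =
      ∃[ D' ] (Unique D' × IsDominating A D' × length D' ≤ length D × weight D' < weight D)

    drop : ∀ {D x} → Unique D → IsDominating A D → (p : x ∈ D) →
      Dominated (D ─ p) x → (∀ z → A x z → Dominated (D ─ p) z) → Improvement D
    drop {D} {x} uD dD p dx dN =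
      (D ─ p) , Unique-─ p uD , IsDominating-replace dD p id dx dN ,
      subst (length (D ─ p) ≤_) (sym (length-─ p)) (n≤1+n _) ,
      subst (weight (D ─ p) <_) (sym (sum-map-─ (suc ∘ cost) p)) (s≤s (m≤n+m _ (cost x)))

    exchange : ∀ {D x y} → Unique D → IsDominating A D → (p : x ∈ D) → y ∉ D → cost y < cost x →
      Dominated (y ∷ (D ─ p)) x → (∀ z → A x z → Dominated (y ∷ (D ─ p)) z) → Improvement D
    exchange {D} {x} {y} uD dD p y∉D wy<wx dx dN =
      y ∷ (D ─ p) , (¬Any⇒All¬ _ (y∉D ∘ ∈-─⁻ p) ∷ Unique-─ p uD) ,
      IsDominating-replace dD p there dx dN ,
      subst (suc (length (D ─ p)) ≤_) (sym (length-─ p)) ≤-refl ,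
      subst (weight (y ∷ (D ─ p)) <_) (sym (sum-map-─ (suc ∘ cost) p)) (+-monoˡ-< _ (s≤s wy<wx))

    all-or-improvement : ∀ {D} xs → (∀ x → x ∈ xs → CertifiedAt D x ⊎ Improvement D) →
      (∀ x → x ∈ xs → CertifiedAt D x) ⊎ Improvement D
    all-or-improvement []       check = inj₁ λ _ ()
    all-or-improvement (x ∷ xs) check
      with check x (here refl) | all-or-improvement xs (λ y → check y ∘ there)
    ... | inj₂ improvement | _ = inj₂ improvement
    ... | inj₁ _ | inj₂ improvement = inj₂ improvement
    ... | inj₁ cx | inj₁ cxs = inj₁ λ { _ (here refl) → cx ; y (there y∈) → cxs y y∈ }

    module _ (certifiedAt-or-improvement : ∀ {D} → Unique D → IsDominating A D →
                                          ∀ x → x ∈ D → CertifiedAt D x ⊎ Improvement D) where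

      certify-acc : ∀ {D} → Acc _<_ (weight D) → Unique D → IsDominating A D → CertifiedReduction D
      certify-acc {D} (acc smaller) uD dD with all-or-improvement D (certifiedAt-or-improvement uD dD)
      ... | inj₁ certified = D , uD , (dD , certified) , ≤-refl
      ... | inj₂ (D' , uD' , dD' , D'≤D , lighter) with certify-acc (smaller lighter) uD' dD'
      ...   | D'' , uD'' , cD'' , D''≤D' = D'' , uD'' , cD'' , ≤-trans D''≤D' D'≤D

      certify : ∀ {D} → Unique D → IsDominating A D → CertifiedReduction D
      certify {D} = certify-acc (<-wellFounded (weight D))

module _ (G : Graph) where

  adj? : ∀ u v → Dec (Adj G u v)
  adj? u v = E G u v Bool.≟ true

  Adj-sym : ∀ {u v} → Adj G u v → Adj G v u
  Adj-sym {u} {v} e = trans (Graph.sym G v u) e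

  Adj-irrefl : ∀ {u v} → Adj G u v → u ≢ v
  Adj-irrefl {u} e refl with trans (sym e) (irrefl G u)
  ... | ()

  Adj-irrelevant : ∀ {u v} (p q : Adj G u v) → p ≡ q
  Adj-irrelevant = Decidable⇒UIP.≡-irrelevant Bool._≟_

  Leaf : Fin (n G) → Set
  Leaf u = ∃[ v ] (Adj G u v × ∀ z → Adj G u z → z ≡ v)

  data Neighbourhood (u : Fin (n G)) : Set where
    isolated  : (∀ v → ¬ Adj G u v) → Neighbourhood u
    leaf      : Leaf u → Neighbourhood u
    branching : ∀ {v w} → v ≢ w → Adj G u v → Adj G u w → Neighbourhood u

  neighbourhood : ∀ u → Neighbourhood u
  neighbourhood u with Fin.any? (adj? u)
  ... | no none = isolated λ v e → none (v , e)
  ... | yes (v , e) with Fin.any? (λ w → adj? u w ×-dec ¬? (w Fin.≟ v))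
  ...   | yes (w , e' , w≢v) = branching (w≢v ∘ sym) e e'
  ...   | no no-other = leaf (v , e , only-v)
    where
    only-v : ∀ z → Adj G u z → z ≡ v
    only-v z e' = decidable-stable (z Fin.≟ v) λ z≢v → no-other (z , e' , z≢v)

  leaf? : ∀ u → Dec (Leaf u)
  leaf? u with neighbourhood u
  ... | isolated none = no λ (v , e , _) → none v e
  ... | leaf l = yes l
  ... | branching v≢w e e' = no λ (_ , _ , only) → v≢w (trans (only _ e) (sym (only _ e')))

  two-leaves⇒component-of-size-2 : ∀ {u v} → Leaf u → Leaf v → Adj G u v → HasComponentOfSize2 G
  two-leaves⇒component-of-size-2 {u} {v} (_ , _ , only-u) (_ , _ , only-v) e =
    u , v , Adj-irrefl e , step e here , λ _ → reach (inj₁ refl)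
    where
    reach : ∀ {a x} → a ≡ u ⊎ a ≡ v → Reach G a x → x ≡ u ⊎ x ≡ v
    reach a∈uv here = a∈uv
    reach (inj₁ refl) (step e' r) = reach (inj₂ (trans (only-u _ e') (sym (only-u _ e)))) r
    reach (inj₂ refl) (step e' r) = reach (inj₁ (trans (only-v _ e') (sym (only-v _ (Adj-sym e))))) r

module Subdivision (G : Graph) (no-K₂ : ¬ HasComponentOfSize2 G) where

  V : Set
  V = S2V G

  A : V → V → Set
  A = S2Adj G

  open Domination A

  -- For e = uv, sub e is the paper's u_e and partner e is v_e.
  sub : ∀ {u v} → Adj G u v → V
  sub {u} {v} e = inj₂ ((u , v) , e)

  partner : ∀ {u v} → Adj G u v → V
  partner e = sub (Adj-sym G e)

  sub-irrelevant : ∀ {u v} (p q : Adj G u v) → sub p ≡ sub q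
  sub-irrelevant p q = cong sub (Adj-irrelevant G p q)

  _≟_ : DecidableEquality V
  _≟_ = ⊎-≡-dec Fin._≟_ (Σ-≡-dec (Σ-≡-dec Fin._≟_ Fin._≟_)
                                         λ p q → yes (Adj-irrelevant G p q))

  open DecMembership _≟_ using (_∈?_)

  vertices : List V
  vertices = deduplicate _≟_ (map inj₁ (allFin (n G)) ++ map inj₂ (sieve (uncurry (adj? G)) pairs))
    where pairs = cartesianProduct (allFin (n G)) (allFin (n G))

  ∈-vertices : ∀ v → v ∈ vertices
  ∈-vertices (inj₁ u) = ∈-deduplicate⁺ _≟_ (∈-++⁺ˡ (∈-map⁺ inj₁ (∈-allFin u)))
  ∈-vertices (inj₂ ((u , v) , e)) = ∈-deduplicate⁺ _≟_ (∈-++⁺ʳ (map inj₁ (allFin (n G)))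
    (∈-map⁺ inj₂ (∈-sieve⁺ _ (Adj-irrelevant G)
                             (∈-cartesianProduct⁺ (∈-allFin u) (∈-allFin v)) e)))

  S2Adj? : ∀ x y → Dec (A x y)
  S2Adj? (inj₁ _) (inj₁ _) = no λ ()
  S2Adj? (inj₁ a) (inj₂ ((u , _) , _)) with a Fin.≟ u
  ... | yes refl = yes (orig-sub _)
  ... | no a≢u   = no λ { (orig-sub _) → a≢u refl }
  S2Adj? (inj₂ ((u , _) , _)) (inj₁ a) with u Fin.≟ a
  ... | yes refl = yes (sub-orig _)
  ... | no u≢a   = no λ { (sub-orig _) → u≢a refl }
  S2Adj? (inj₂ ((u , v) , _)) (inj₂ ((v′ , u′) , _)) with v′ Fin.≟ v | u′ Fin.≟ u
  ... | yes refl | yes refl = yes (sub-sub _ _)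
  ... | no v′≢v  | _        = no λ { (sub-sub _ _) → v′≢v refl }
  ... | _        | no u′≢u  = no λ { (sub-sub _ _) → u′≢u refl }

  dominationNumber-exists : ∃[ k ] IsDominationNumber A k
  dominationNumber-exists =
    minCard-exists _≟_ (dominating? _≟_ S2Adj? ∈-vertices) IsDominating-mono
      (deduplicate-! _≟_ _) ∈-vertices (λ v → inj₁ (∈-vertices v))

  ∀-neighbour-sub : ∀ {u v} {P : V → Set} (e : Adj G u v) → P (inj₁ u) → P (partner e) →
                    ∀ z → A (sub e) z → P z
  ∀-neighbour-sub e P-origin P-partner _ (sub-orig _)    = P-origin
  ∀-neighbour-sub {P = P} e P-origin P-partner _ (sub-sub _ e′) =
    subst P (sub-irrelevant (Adj-sym G e) e′) P-partner

  partner≢sub : ∀ {u v} (e : Adj G u v) → partner e ≢ sub e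
  partner≢sub e eq = Adj-irrefl G e (sym (cong (proj₁ ∘ proj₁) (inj₂-injective eq)))

  ¬adjacent-leaves : ∀ {u v} → Leaf G u → Leaf G v → ¬ Adj G u v
  ¬adjacent-leaves lu lv e = no-K₂ (two-leaves⇒component-of-size-2 G lu lv e)

  -- Positions for a vertex of D, from best to worst: a non-leaf vertex of G, a subdivision
  -- vertex next to a leaf, and (equally) a leaf or a subdivision vertex next to a non-leaf.
  cost : V → ℕ
  cost (inj₁ u)              = if does (leaf? G u) then 2 else 0
  cost (inj₂ ((u , _) , _)) = if does (leaf? G u) then 1 else 2

  nonleaf<sub : ∀ {u x y} → ¬ Leaf G u → (e : Adj G x y) → cost (inj₁ u) < cost (sub e)
  nonleaf<sub {u} {x} ¬lu e rewrite dec-false (leaf? G u) ¬lu with does (leaf? G x)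
  ... | true  = s≤s z≤n
  ... | false = s≤s z≤n

  sub<leaf : ∀ {u v} → Leaf G u → (e : Adj G u v) → cost (sub e) < cost (inj₁ u)
  sub<leaf {u} lu e rewrite dec-true (leaf? G u) lu = s≤s (s≤s z≤n)

  sub<partner : ∀ {u v} → ¬ Leaf G u → Leaf G v → (e : Adj G u v) → cost (partner e) < cost (sub e)
  sub<partner {u} {v} ¬lu lv e rewrite dec-false (leaf? G u) ¬lu | dec-true (leaf? G v) lv =
    s≤s (s≤s z≤n)

  module _ {D} (uD : Unique D) (dD : IsDominating A D) where
    open Descent cost

    module _ {u v} (e : Adj G u v) (p : sub e ∈ D) where

      sub∈∧origin∈⇒improvable : inj₁ u ∈ D → Improvement D
      sub∈∧origin∈⇒improvable u∈D with partner e ∈? D | inj₁ v ∈? D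
      ... | yes partner∈D | _ =
        drop uD dD p (inj₂ (inj₁ u , u∈D─p , orig-sub e))
          (∀-neighbour-sub e (inj₁ u∈D─p) (inj₁ (∈-─⁺ p partner∈D (partner≢sub e))))
        where u∈D─p = ∈-─⁺ p u∈D λ ()
      ... | no _ | yes v∈D =
        drop uD dD p (inj₂ (inj₁ u , u∈D─p , orig-sub e))
          (∀-neighbour-sub e (inj₁ u∈D─p)
            (inj₂ (inj₁ v , ∈-─⁺ p v∈D (λ ()) , orig-sub (Adj-sym G e))))
        where u∈D─p = ∈-─⁺ p u∈D λ ()
      ... | no partner∉D | no v∉D with leaf? G v
      ...   | yes lv =
        exchange uD dD p partner∉D (sub<partner (λ lu → ¬adjacent-leaves lu lv e) lv e)
          (inj₂ (partner e , here refl , sub-sub (Adj-sym G e) e))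
          (∀-neighbour-sub e (inj₁ (there (∈-─⁺ p u∈D λ ()))) (inj₁ (here refl)))
      ...   | no ¬lv =
        exchange uD dD p v∉D (nonleaf<sub ¬lv e)
          (inj₂ (inj₁ u , u∈D─p , orig-sub e))
          (∀-neighbour-sub e (inj₁ u∈D─p) (inj₂ (inj₁ v , here refl , orig-sub (Adj-sym G e))))
        where u∈D─p = there (∈-─⁺ p u∈D λ ())

      sub∈∧partner∈⇒improvable : ¬ Leaf G u → partner e ∈ D → Improvement D
      sub∈∧partner∈⇒improvable ¬lu partner∈D with inj₁ u ∈? D
      ... | yes u∈D = sub∈∧origin∈⇒improvable u∈D
      ... | no u∉D  =
        exchange uD dD p u∉D (nonleaf<sub ¬lu e)
          (inj₂ (inj₁ u , here refl , orig-sub e))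
          (∀-neighbour-sub e (inj₁ (here refl)) (inj₁ (there (∈-─⁺ p partner∈D (partner≢sub e)))))

    certifiedAt-sub-or-improvement : ∀ {u v} (e : Adj G u v) → sub e ∈ D →
                                     CertifiedAt D (sub e) ⊎ Improvement D
    certifiedAt-sub-or-improvement {u} e p with inj₁ u ∈? D | partner e ∈? D
    ... | yes u∈D | _ = inj₂ (sub∈∧origin∈⇒improvable e p u∈D)
    ... | no u∉D | no partner∉D =
      inj₁ (inj₂ (inj₁ u , partner e , (λ ()) , sub-orig e , sub-sub e (Adj-sym G e) , u∉D , partner∉D))
    ... | no _ | yes partner∈D with leaf? G u
    ...   | no ¬lu = inj₂ (sub∈∧partner∈⇒improvable e p ¬lu partner∈D)
    ...   | yes lu = inj₂ (sub∈∧partner∈⇒improvable (Adj-sym G e) partner∈D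
                             (λ lv → ¬adjacent-leaves lu lv e) (subst (_∈ D) (sub-irrelevant _ _) p))

    sub∈? : ∀ u v → Dec (Σ (Adj G u v) λ e → sub e ∈ D)
    sub∈? u v with adj? G u v
    ... | no ¬e = no (¬e ∘ proj₁)
    ... | yes e = map′ (e ,_) (λ (e′ , m) → subst (_∈ D) (sub-irrelevant e′ e) m) (sub e ∈? D)

    certifiedAt-origin-or-improvement : ∀ u → inj₁ u ∈ D → CertifiedAt D (inj₁ u) ⊎ Improvement D
    certifiedAt-origin-or-improvement u u∈D with Fin.any? (sub∈? u)
    ... | yes (_ , e , p) = inj₂ (sub∈∧origin∈⇒improvable e p u∈D)
    ... | no none with neighbourhood G u
    ...   | isolated ¬adj = inj₁ (inj₁ λ { _ (orig-sub e) → ⊥-elim (¬adj _ e) })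
    ...   | branching v≢w e e′ =
      inj₁ (inj₂ (sub e , sub e′ , (λ { refl → v≢w refl }) , orig-sub e , orig-sub e′ ,
                  (λ p → none (_ , e , p)) , (λ p → none (_ , e′ , p))))
    ...   | leaf lu@(v , e , only-v) =
      inj₂ (exchange uD dD u∈D (λ p → none (v , e , p)) (sub<leaf lu e)
              (inj₂ (sub e , here refl , sub-orig e))
              λ { _ (orig-sub e′) → inj₁ (here (sub-at-leaf e′)) })
      where
      sub-at-leaf : ∀ {z} (e′ : Adj G u z) → sub e′ ≡ sub e
      sub-at-leaf e′ with only-v _ e′
      ... | refl = sub-irrelevant e′ e

    certifiedAt-or-improvement : ∀ x → x ∈ D → CertifiedAt D x ⊎ Improvement D
    certifiedAt-or-improvement (inj₁ u)             = certifiedAt-origin-or-improvement u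
    certifiedAt-or-improvement (inj₂ ((u , v) , e)) = certifiedAt-sub-or-improvement e

  dominationNumber-certified : ∀ {k} → IsDominationNumber A k → IsCertifiedDominationNumber A k
  dominationNumber-certified =
    dominationNumber⇒certifiedDominationNumber (Descent.certify cost certifiedAt-or-improvement)

corollary2p14 : (G : Graph) → ¬ HasComponentOfSize2 G →
    ∃[ k ] (IsDominationNumber (S2Adj G) k × IsCertifiedDominationNumber (S2Adj G) k)
corollary2p14 G no-K₂ =
  let open Subdivision G no-K₂
      (k , γ) = dominationNumber-exists
  in k , γ , dominationNumber-certified γ
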